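{- Let $(X,\mathcal{C})$ be an acyclic convex geometry with aggregated critical base $(X,\Sigma^*_{\mathrm{crit}})$. For each $\mu\in\{\mathrm{cdeg},\mathrm{pdeg},\deg\}$, $\mu(\Sigma^*_{\mathrm{crit}})=\min\{\mu(\Sigma): (X,\Sigma)\text{ is an implicational base of }(X,\mathcal{C})\}$.
   Context: A closure system on a finite set $X$ is a family $\mathcal{C}\subseteq2^X$ with $X,\emptyset\in\mathcal{C}$, closed under intersection, closure operator $\phi(A)=\bigcap\{C\in\mathcal{C}:A\subseteq C\}$. An implicational base (IB) of $(X,\mathcal{C})$ is a set $\Sigma$ of implications $A\to B$ with $A,B\subseteq X$ disjoint, such that the sets $C$ with $A\subseteq C\Rightarrow B\subseteq C$ for all $A\to B\in\Sigma$ are exactly $\mathcal{C}$. $(X,\mathcal{C})$ is an acyclic convex geometry if it has an IB whose implication graph (arc $ab$ whenever $a\in A,b\in B$ for some $A\to B$) is acyclic. A minimal generator of $b$ is an inclusion-minimal $A\subseteq X\setminus\{b\}$ with $b\in\phi(A)$; it is critical if $\phi(A)\setminus\{a,b\}\in\mathcal{C}$ for all $a\in A$. The critical base is $\Sigma_{\mathrm{crit}}=\{A\to b: A\text{ a critical generator of }b\}$, and its aggregation $\Sigma^*_{\mathrm{crit}}$ replaces all implications with a common premise $A$ by the single implication $A\to\bigcup\{B: A\to B\in\Sigma_{\mathrm{crit}}\}$. For an IB $\Sigma$ and $x\in X$: $\mathrm{pdeg}(x)$ is the number of implications whose premise contains $x$, $\mathrm{cdeg}(x)$ the number whose conclusion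 contains $x$, $\deg(x)$ the number in which $x$ appears; $\mathrm{pdeg}(\Sigma),\mathrm{cdeg}(\Sigma),\deg(\Sigma)$ are the maxima over $x\in X$. -}

module Defs where

open import Data.Nat using (ℕ; zero; suc; _⊔_; _≤_)
open import Data.Fin using (Fin)
open import Data.Fin.Subset using (Subset; _∈_; _∉_; _⊆_; _⊂_; _∩_; _-_; ⊤; ⊥)
open import Data.Fin.Subset.Properties using (_∈?_; _⊆?_)
open import Data.List using (List; []; _∷_; foldr; filter; length; map; allFin)
open import Data.List.Relation.Unary.Unique.Propositional using (Unique)
import Data.List.Membership.Propositional as L
open import Data.Product using (_×_; _,_; ∃; ∃-syntax; proj₁; proj₂)
open import Data.Sum using (_⊎_)
open import Data.Empty using () renaming (⊥ to Empty)
open import Relation.Nullary using (¬_; Dec; yes; no)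
open import Relation.Binary.Construct.Closure.Transitive using (TransClosure)
open import Function.Bundles using (_⇔_)

-- An implication A → B on the ground set X = Fin n, as a pair (premise , conclusion).
Impl : ℕ → Set
Impl n = Subset n × Subset n

Family : ℕ → Set
Family n = List (Subset n)

record ClosureSystem {n : ℕ} (𝒞 : Family n) : Set where
  field
    top∈   : ⊤ L.∈ 𝒞
    bot∈   : ⊥ L.∈ 𝒞
    ∩-closed : ∀ C D → C L.∈ 𝒞 → D L.∈ 𝒞 → (C ∩ D) L.∈ 𝒞

φ : {n : ℕ} → Family n → Subset n → Subset n
φ 𝒞 A = foldr _∩_ ⊤ (filter (A ⊆?_) 𝒞)

Respects : {n : ℕ} → List (Impl n) → Subset n → Set
Respects Σ C = ∀ A B → (A , B) L.∈ Σ → A ⊆ C → B ⊆ C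

record IsIB {n : ℕ} (𝒞 : Family n) (Σ : List (Impl n)) : Set where
  field
    unique   : Unique Σ
    disjoint : ∀ A B → (A , B) L.∈ Σ → ∀ x → x ∈ A → x ∈ B → Empty
    models   : ∀ C → (C L.∈ 𝒞 ⇔ Respects Σ C)

Arc : {n : ℕ} → List (Impl n) → Fin n → Fin n → Set
Arc Σ a b = ∃[ A ] ∃[ B ] ((A , B) L.∈ Σ × a ∈ A × b ∈ B)

AcyclicGraph : {n : ℕ} → List (Impl n) → Set
AcyclicGraph {n} Σ = ∀ (a : Fin n) → ¬ TransClosure (Arc Σ) a a

AcyclicConvexGeometry : {n : ℕ} → Family n → Set
AcyclicConvexGeometry 𝒞 = ClosureSystem 𝒞 × ∃[ Σ ] (IsIB 𝒞 Σ × AcyclicGraph Σ)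

MinGen : {n : ℕ} → Family n → Subset n → Fin n → Set
MinGen 𝒞 A b = b ∉ A × b ∈ φ 𝒞 A × (∀ A′ → A′ ⊂ A → b ∉ φ 𝒞 A′)

CritGen : {n : ℕ} → Family n → Subset n → Fin n → Set
CritGen 𝒞 A b = MinGen 𝒞 A b × (∀ a → a ∈ A → ((φ 𝒞 A - a) - b) L.∈ 𝒞)

IsAggCritBase : {n : ℕ} → Family n → List (Impl n) → Set
IsAggCritBase 𝒞 Σ =
  Unique Σ ×
  (∀ A B → ((A , B) L.∈ Σ) ⇔ ((∃[ b ] (b ∈ B)) × (∀ b → (b ∈ B ⇔ CritGen 𝒞 A b))))

data Measure : Set where
  cdeg pdeg deg : Measure

Occurs : {n : ℕ} → Measure → Fin n → Impl n → Set
Occurs cdeg x (A , B) = x ∈ B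
Occurs pdeg x (A , B) = x ∈ A
Occurs deg  x (A , B) = x ∈ A ⊎ x ∈ B

occurs? : {n : ℕ} → (μ : Measure) → (x : Fin n) → (i : Impl n) → Dec (Occurs μ x i)
occurs? cdeg x (A , B) = x ∈? B
occurs? pdeg x (A , B) = x ∈? A
occurs? deg  x (A , B) with x ∈? A | x ∈? B
... | yes p | _     = yes (Data.Sum.inj₁ p)
... | no _  | yes q = yes (Data.Sum.inj₂ q)
... | no ¬p | no ¬q = no λ { (Data.Sum.inj₁ p) → ¬p p ; (Data.Sum.inj₂ q) → ¬q q }

degAt : {n : ℕ} → Measure → List (Impl n) → Fin n → ℕ
degAt μ Σ x = length (filter (occurs? μ x) Σ)

degOf : {n : ℕ} → Measure → List (Impl n) → ℕ
degOf {n} μ Σ = foldr _⊔_ 0 (map (degAt μ Σ) (allFin n))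

-- If A is a critical generator of b, the set φ(A) ∖ b is not closed, so every base Σ has an
-- implication A′ → B′ violated by it: A′ ⊆ φ(A) ∖ b and b ∈ B′. Criticality forces A ⊆ A′, and A′
-- determines A. Hence the implications of Σ*_crit in which x occurs inject into those of Σ in which
-- x occurs, and μ(Σ*_crit) ≤ μ(Σ).
--
-- Conversely Σ*_crit is itself a base once some base has an acyclic implication graph. Then every
-- closed set is generated by its extreme points, so each element a of a minimal generator A of b is
-- extreme in φ(A); moreover a is an ancestor of b. If A is not critical, some φ(A) ∖ {a,b} is not
-- closed, and the implication it violates yields a minimal generator of b with smaller closure; so
-- every minimal generator has a critical one below it. Finally, if C respects Σ*_crit and s is a
-- graph-minimal element of φ(C) ∖ C, a critical generator of s below a minimal generator inside C
-- consists of ancestors of s in φ(C), hence lies in C, and so s ∈ C.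

module Submission where

open import Data.Bool using () renaming (_≟_ to _≟ᵇ_)
open import Data.Empty using (⊥-elim)
open import Data.Fin using (Fin; zero; suc; _≟_)
open import Data.Fin.Induction using (spo-wellFounded; spo-noetherian)
open import Data.Fin.Properties using (any?; all?)
open import Data.Fin.Subset
  using (Subset; _∈_; _∉_; _⊆_; _⊂_; _∩_; _∪_; ∁; _─_; _-_; ⁅_⁆; ⊤; inside; outside)
open import Data.Fin.Subset.Induction using (⊂-wellFounded)
open import Data.Fin.Subset.Properties
  using ( _∈?_; _⊆?_; _⊂?_; anySubset?; ⊆-antisym; ⊆-⊂-trans; ∈⊤; x∈⁅x⁆
        ; x∈p∩q⁺; x∈p∩q⁻; p∩q⊆p; x∈p∪q⁺; x∈p∪q⁻; x∉p⇒x∈∁p; x∈∁p⇒x∉p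
        ; p─q⊆p; x∈p∧x∉q⇒x∈p─q; x∈p∧x≢y⇒x∈p-y; x∈p⇒p-x⊂p; p─x─y≡p─y─x)
open import Data.List using (List; []; _∷_; foldr; map; filter; length; allFin)
open import Data.List.Properties using (length-removeAt′)
import Data.List.Membership.DecPropositional as DecMembership
open import Data.List.Membership.Propositional using (find; lose) renaming (_∈_ to _∈ₗ_)
open import Data.List.Membership.Propositional.Properties using (∈-filter⁺; ∈-filter⁻)
import Data.List.Relation.Unary.All as All
open import Data.List.Relation.Unary.All.Properties using (¬All⇒Any¬)
open import Data.List.Relation.Unary.AllPairs using (_∷_)
import Data.List.Relation.Unary.Any as Any
open import Data.List.Relation.Unary.Any using (here; there)
open import Data.List.Relation.Unary.Unique.Propositional using (Unique)
open import Data.List.Relation.Unary.Unique.Propositional.Properties using (filter⁺)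
open import Data.Nat using (ℕ; zero; suc; _≤_; _⊔_; z≤n; s≤s)
open import Data.Nat.Properties using (⊔-mono-≤)
open import Data.Product using (_×_; _,_; ∃-syntax; proj₁; proj₂)
open import Data.Sum using (_⊎_; inj₁; inj₂)
open import Data.Vec using ([]; _∷_; here; there)
open import Data.Vec.Properties using (≡-dec)
open import Function using (_∘_; id; flip; _on_)
open import Function.Bundles using (_⇔_; mk⇔; Equivalence)
open import Induction.WellFounded using (WellFounded; Acc; acc)
open import Level using (Level)
open import Relation.Binary using (Rel; Decidable; IsStrictPartialOrder)
import Relation.Binary.Construct.On as On
open import Relation.Binary.Construct.Closure.Transitive using (TransClosure; [_]; _∷_; _++_)
open import Relation.Binary.PropositionalEquality
  using (_≡_; _≢_; refl; sym; subst; cong₂; isEquivalence)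
open import Relation.Nullary using (¬_; Dec; yes; no; does; contradiction)
open import Relation.Nullary.Decidable
  using (_×-dec_; _⊎-dec_; _→-dec_; ¬?; map′; decidable-stable)

open import Defs

private variable
  ℓ : Level
  n : ℕ
  x y : Fin n
  p q : Subset n

x∈p─q⇒x∉q : ∀ (p q : Subset n) → x ∈ p ─ q → x ∉ q
x∈p─q⇒x∉q (_ ∷ p) (inside  ∷ q) ()        here
x∈p─q⇒x∉q (_ ∷ p) (inside  ∷ q) (there m) (there k) = x∈p─q⇒x∉q p q m k
x∈p─q⇒x∉q (_ ∷ p) (outside ∷ q) (there m) (there k) = x∈p─q⇒x∉q p q m k

x∈p∧x∉p─q⇒x∈q : x ∈ p → x ∉ p ─ q → x ∈ q
x∈p∧x∉p─q⇒x∈q {x = x} {q = q} x∈p x∉p─q with x ∈? q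
... | yes x∈q = x∈q
... | no  x∉q = contradiction (x∈p∧x∉q⇒x∈p─q x∈p x∉q) x∉p─q

x∈p-y⇒x∈p : x ∈ p - y → x ∈ p
x∈p-y⇒x∈p {p = p} {y = y} = p─q⊆p p ⁅ y ⁆

y∉p-y : y ∉ p - y
y∉p-y {y = y} {p = p} x∈ = x∈p─q⇒x∉q p ⁅ y ⁆ x∈ (x∈⁅x⁆ y)

p⊆q∧x∉p⇒p⊆q-x : p ⊆ q → x ∉ p → p ⊆ q - x
p⊆q∧x∉p⇒p⊆q-x p⊆q x∉p y∈p = x∈p∧x≢y⇒x∈p-y (p⊆q y∈p) λ { refl → x∉p y∈p }

p⊆q∧p⊈q-y⇒y∈p : p ⊆ q → ¬ p ⊆ q - y → y ∈ p
p⊆q∧p⊈q-y⇒y∈p {p = p} {y = y} p⊆q p⊈q-y with y ∈? p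
... | yes y∈p = y∈p
... | no  y∉p = ⊥-elim (p⊈q-y (p⊆q∧x∉p⇒p⊆q-x p⊆q y∉p))

toSubset : {P : Fin n → Set ℓ} → (∀ i → Dec (P i)) → Subset n
toSubset {n = zero}  P? = []
toSubset {n = suc n} P? = does (P? zero) ∷ toSubset (P? ∘ suc)

∈-toSubset⁺ : {P : Fin n → Set ℓ} (P? : ∀ i → Dec (P i)) → P x → x ∈ toSubset P?
∈-toSubset⁺ {x = zero} P? Px with P? zero
... | yes _   = here
... | no  ¬Px = contradiction Px ¬Px
∈-toSubset⁺ {x = suc x} P? Px = there (∈-toSubset⁺ (P? ∘ suc) Px)

∈-toSubset⁻ : {P : Fin n → Set ℓ} (P? : ∀ i → Dec (P i)) → x ∈ toSubset P? → P x
∈-toSubset⁻ {x = zero} P? x∈ with P? zero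
∈-toSubset⁻ {x = zero} P? here | yes Px = Px
∈-toSubset⁻ {x = suc x} P? (there x∈) = ∈-toSubset⁻ (P? ∘ suc) x∈

_∈ₗ?_ : (C : Subset n) (𝒞 : Family n) → Dec (C ∈ₗ 𝒞)
_∈ₗ?_ = DecMembership._∈?_ (≡-dec _≟ᵇ_)

module Closure (𝒞 : Family n) where

  φ-extensive : ∀ A → A ⊆ φ 𝒞 A
  φ-extensive A = go 𝒞
    where
    go : ∀ Cs → A ⊆ foldr _∩_ ⊤ (filter (A ⊆?_) Cs)
    go []       x∈A = ∈⊤
    go (C ∷ Cs) x∈A with A ⊆? C
    ... | yes A⊆C = x∈p∩q⁺ (A⊆C x∈A , go Cs x∈A)
    ... | no  _   = go Cs x∈A

  φ-least : ∀ {A C} → C ∈ₗ 𝒞 → A ⊆ C → φ 𝒞 A ⊆ C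
  φ-least {A} {C} C∈𝒞 A⊆C = go 𝒞 C∈𝒞
    where
    go : ∀ Cs → C ∈ₗ Cs → foldr _∩_ ⊤ (filter (A ⊆?_) Cs) ⊆ C
    go (D ∷ Cs) (here refl) x∈ with A ⊆? D
    ... | yes _   = proj₁ (x∈p∩q⁻ D _ x∈)
    ... | no  A⊈C = ⊥-elim (A⊈C A⊆C)
    go (D ∷ Cs) (there C∈) x∈ with A ⊆? D
    ... | yes _ = go Cs C∈ (proj₂ (x∈p∩q⁻ D _ x∈))
    ... | no  _ = go Cs C∈ x∈

  φ-remove∉𝒞 : ∀ {C s} → s ∈ φ 𝒞 C → s ∉ C → ¬ (φ 𝒞 C - s) ∈ₗ 𝒞
  φ-remove∉𝒞 s∈φC s∉C φC-s∈𝒞 =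
    y∉p-y (φ-least φC-s∈𝒞 (p⊆q∧x∉p⇒p⊆q-x (φ-extensive _) s∉C) s∈φC)

  minimal-generator-below : ∀ {F b} → b ∈ φ 𝒞 F → b ∉ F → ∃[ A ] (A ⊆ F × MinGen 𝒞 A b)
  minimal-generator-below {F} {b} = go (⊂-wellFounded F)
    where
    go : ∀ {F} → Acc _⊂_ F → b ∈ φ 𝒞 F → b ∉ F → ∃[ A ] (A ⊆ F × MinGen 𝒞 A b)
    go {F} (acc rec) b∈φF b∉F with anySubset? (λ A → (A ⊂? F) ×-dec (b ∈? φ 𝒞 A))
    ... | no  ∄A = F , id , b∉F , b∈φF , λ A A⊂F b∈φA → ∄A (A , A⊂F , b∈φA)
    ... | yes (A , A⊂F , b∈φA) with go (rec A⊂F) b∈φA (b∉F ∘ proj₁ A⊂F)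
    ...   | A′ , A′⊆A , mg = A′ , proj₁ A⊂F ∘ A′⊆A , mg

  minGen? : ∀ A b → Dec (MinGen 𝒞 A b)
  minGen? A b = ¬? (b ∈? A) ×-dec (b ∈? φ 𝒞 A) ×-dec noSmaller?
    where
    noSmaller? : Dec (∀ A′ → A′ ⊂ A → b ∉ φ 𝒞 A′)
    noSmaller? = map′ (λ ∄A′ A′ A′⊂A b∈ → ∄A′ (A′ , A′⊂A , b∈))
                      (λ none (A′ , A′⊂A , b∈) → none A′ A′⊂A b∈)
                      (¬? (anySubset? λ A′ → (A′ ⊂? A) ×-dec (b ∈? φ 𝒞 A′)))

  critGen? : ∀ A b → Dec (CritGen 𝒞 A b)
  critGen? A b = minGen? A b ×-dec all? (λ a → (a ∈? A) →-dec ((φ 𝒞 A - a - b) ∈ₗ? 𝒞))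

  module _ (cs : ClosureSystem 𝒞) where
    open ClosureSystem cs

    φ-closed : ∀ A → φ 𝒞 A ∈ₗ 𝒞
    φ-closed A = go 𝒞 id
      where
      go : ∀ Cs → (∀ {C} → C ∈ₗ Cs → C ∈ₗ 𝒞) → foldr _∩_ ⊤ (filter (A ⊆?_) Cs) ∈ₗ 𝒞
      go []       _   = top∈
      go (C ∷ Cs) Cs⊆ with A ⊆? C
      ... | yes _ = ∩-closed C _ (Cs⊆ (here refl)) (go Cs (Cs⊆ ∘ there))
      ... | no  _ = go Cs (Cs⊆ ∘ there)

    φ-mono : ∀ {A B} → A ⊆ B → φ 𝒞 A ⊆ φ 𝒞 B
    φ-mono A⊆B = φ-least (φ-closed _) (φ-extensive _ ∘ A⊆B)

    φ⊆⇒∈𝒞 : ∀ {C} → φ 𝒞 C ⊆ C → C ∈ₗ 𝒞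
    φ⊆⇒∈𝒞 {C} φC⊆C = subst (_∈ₗ 𝒞) (⊆-antisym φC⊆C (φ-extensive C)) (φ-closed C)

→-violated : ∀ {ℓ₁ ℓ₂} {P : Set ℓ₁} {Q : Set ℓ₂} → Dec P → ¬ (P → Q) → P × ¬ Q
→-violated (yes p) ¬[p→q] = p , λ q → ¬[p→q] (λ _ → q)
→-violated (no ¬p) ¬[p→q] = ⊥-elim (¬[p→q] (⊥-elim ∘ ¬p))

violated : (Σ : List (Impl n)) (T : Subset n) → ¬ Respects Σ T →
           ∃[ A ] ∃[ B ] ((A , B) ∈ₗ Σ × A ⊆ T × ¬ B ⊆ T)
violated Σ T ¬resp with All.all? (λ { (A , B) → (A ⊆? T) →-dec (B ⊆? T) }) Σ
... | yes all = ⊥-elim (¬resp λ A B m → All.lookup all m)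
... | no ¬all with find (¬All⇒Any¬ (λ { (A , B) → (A ⊆? T) →-dec (B ⊆? T) }) Σ ¬all)
...   | (A , B) , m , ¬imp with →-violated (A ⊆? T) ¬imp
...     | A⊆T , B⊈T = A , B , m , A⊆T , B⊈T

module Base {𝒞 : Family n} (cs : ClosureSystem 𝒞) {Σ : List (Impl n)} (ib : IsIB 𝒞 Σ) where
  open Closure 𝒞

  respected : ∀ {C} → C ∈ₗ 𝒞 → Respects Σ C
  respected {C} = Equivalence.to (IsIB.models ib C)

  closed : ∀ {C} → Respects Σ C → C ∈ₗ 𝒞
  closed {C} = Equivalence.from (IsIB.models ib C)

  conclusion⊆φ-premise : ∀ {A B} → (A , B) ∈ₗ Σ → B ⊆ φ 𝒞 A
  conclusion⊆φ-premise m = respected (φ-closed cs _) _ _ m (φ-extensive _)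

  removal-witness : ∀ {P s} → P ∈ₗ 𝒞 → ¬ (P - s) ∈ₗ 𝒞 →
                    ∃[ A ] ∃[ B ] ((A , B) ∈ₗ Σ × A ⊆ P - s × s ∈ B)
  removal-witness {P} {s} P∈𝒞 P-s∉𝒞 with violated Σ (P - s) (P-s∉𝒞 ∘ closed)
  ... | A , B , m , A⊆P-s , B⊈P-s =
    A , B , m , A⊆P-s , p⊆q∧p⊈q-y⇒y∈p (respected P∈𝒞 A B m (x∈p-y⇒x∈p ∘ A⊆P-s)) B⊈P-s

module Critical {𝒞 : Family n} (cs : ClosureSystem 𝒞) where
  open Closure 𝒞

  critical-⊆ : ∀ {A b a D} → CritGen 𝒞 A b → a ∈ A → D ⊆ φ 𝒞 A - b → a ∉ D →
               φ 𝒞 D ⊆ φ 𝒞 A - a - b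
  critical-⊆ {A} {b} {a} (_ , critical) a∈A D⊆φA-b a∉D =
    φ-least (critical a a∈A) (subst (_ ⊆_) (p─x─y≡p─y─x (φ 𝒞 A) b a) (p⊆q∧x∉p⇒p⊆q-x D⊆φA-b a∉D))

  critical-hit : ∀ {Σ A b} → IsIB 𝒞 Σ → CritGen 𝒞 A b →
                 ∃[ A′ ] ∃[ B′ ] ((A′ , B′) ∈ₗ Σ × A ⊆ A′ × A′ ⊆ φ 𝒞 A - b × b ∈ B′)
  critical-hit {A = A} ib cg@((b∉A , b∈φA , _) , _)
    with Base.removal-witness cs ib (φ-closed cs A) (φ-remove∉𝒞 b∈φA b∉A)
  ... | A′ , B′ , m , A′⊆φA-b , b∈B′ = A′ , B′ , m , A⊆A′ , A′⊆φA-b , b∈B′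
    where
    A⊆A′ : A ⊆ A′
    A⊆A′ {a} a∈A with a ∈? A′
    ... | yes a∈A′ = a∈A′
    ... | no  a∉A′ =
      ⊥-elim (y∉p-y (critical-⊆ cg a∈A A′⊆φA-b a∉A′ (Base.conclusion⊆φ-premise cs ib m b∈B′)))

  critical-premise-⊆ : ∀ {A₁ b₁ A₂} → CritGen 𝒞 A₁ b₁ → A₂ ⊆ φ 𝒞 A₁ - b₁ → A₁ ⊆ φ 𝒞 A₂ → A₁ ⊆ A₂
  critical-premise-⊆ {A₂ = A₂} cg A₂⊆φA₁-b₁ A₁⊆φA₂ {a} a∈A₁ with a ∈? A₂
  ... | yes a∈A₂ = a∈A₂
  ... | no  a∉A₂ = ⊥-elim (y∉p-y (x∈p-y⇒x∈p (critical-⊆ cg a∈A₁ A₂⊆φA₁-b₁ a∉A₂ (A₁⊆φA₂ a∈A₁))))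

  critical-premises-unique : ∀ {A₁ b₁ A₂ b₂ D} → CritGen 𝒞 A₁ b₁ → CritGen 𝒞 A₂ b₂ →
                             A₁ ⊆ D → D ⊆ φ 𝒞 A₁ - b₁ → A₂ ⊆ D → D ⊆ φ 𝒞 A₂ - b₂ → A₁ ≡ A₂
  critical-premises-unique cg₁ cg₂ A₁⊆D D⊆₁ A₂⊆D D⊆₂ = ⊆-antisym
    (critical-premise-⊆ cg₁ (D⊆₁ ∘ A₂⊆D) (x∈p-y⇒x∈p ∘ D⊆₂ ∘ A₁⊆D))
    (critical-premise-⊆ cg₂ (D⊆₂ ∘ A₁⊆D) (x∈p-y⇒x∈p ∘ D⊆₁ ∘ A₂⊆D))

module AggregatedCriticalBase {𝒞 : Family n} {Σ* : List (Impl n)} (agg : IsAggCritBase 𝒞 Σ*) where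
  open Closure 𝒞

  private
    characterisation : ∀ {A B} → (A , B) ∈ₗ Σ* → (∃[ b ] b ∈ B) × (∀ b → (b ∈ B ⇔ CritGen 𝒞 A b))
    characterisation {A} {B} = Equivalence.to (proj₂ agg A B)

  conclusion-nonempty : ∀ {A B} → (A , B) ∈ₗ Σ* → ∃[ b ] b ∈ B
  conclusion-nonempty = proj₁ ∘ characterisation

  conclusion-critical : ∀ {A B b} → (A , B) ∈ₗ Σ* → b ∈ B → CritGen 𝒞 A b
  conclusion-critical {b = b} m = Equivalence.to (proj₂ (characterisation m) b)

  conclusion-unique : ∀ {A B₁ B₂} → (A , B₁) ∈ₗ Σ* → (A , B₂) ∈ₗ Σ* → B₁ ≡ B₂
  conclusion-unique m₁ m₂ = ⊆-antisym (transport m₁ m₂) (transport m₂ m₁)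
    where
    transport : ∀ {A B₁ B₂} → (A , B₁) ∈ₗ Σ* → (A , B₂) ∈ₗ Σ* → B₁ ⊆ B₂
    transport m₁ m₂ {b} b∈B₁ = Equivalence.from (proj₂ (characterisation m₂) b) (conclusion-critical m₁ b∈B₁)

  critical∈Σ* : ∀ {A b} → CritGen 𝒞 A b → ∃[ B ] ((A , B) ∈ₗ Σ* × b ∈ B)
  critical∈Σ* {A} {b} cg =
    B , Equivalence.from (proj₂ agg A B) ((b , b∈B) , λ _ → mk⇔ (∈-toSubset⁻ (critGen? A)) (∈-toSubset⁺ (critGen? A))) , b∈B
    where
    B = toSubset (critGen? A)
    b∈B = ∈-toSubset⁺ (critGen? A) cg

∈-─⁺ : ∀ {a} {X : Set a} {y z : X} {ys} (y∈ys : y ∈ₗ ys) → z ∈ₗ ys → z ≢ y → z ∈ₗ (ys Any.─ y∈ys)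
∈-─⁺ (here refl) (here refl) z≢y = contradiction refl z≢y
∈-─⁺ (here refl) (there z∈)  _   = z∈
∈-─⁺ (there y∈)  (here refl) _   = here refl
∈-─⁺ (there y∈)  (there z∈)  z≢y = there (∈-─⁺ y∈ z∈ z≢y)

length-≤-by-injection : ∀ {a b r} {X : Set a} {Y : Set b} (R : X → Y → Set r) {xs : List X} {ys : List Y} →
  Unique xs →
  (∀ {x} → x ∈ₗ xs → ∃[ y ] (y ∈ₗ ys × R x y)) →
  (∀ {x x′ y} → x ∈ₗ xs → x′ ∈ₗ xs → R x y → R x′ y → x ≡ x′) →
  length xs ≤ length ys
length-≤-by-injection R {[]}     _               _     _   = z≤n
length-≤-by-injection R {x ∷ xs} {ys} (x∉xs ∷ uniq) image inj with image (here refl)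
... | y , y∈ys , Rxy =
  subst (suc (length xs) ≤_) (sym (length-removeAt′ ys (Any.index y∈ys)))
        (s≤s (length-≤-by-injection R uniq image′ (λ m m′ → inj (there m) (there m′))))
  where
  image′ : ∀ {x′} → x′ ∈ₗ xs → ∃[ y′ ] (y′ ∈ₗ (ys Any.─ y∈ys) × R x′ y′)
  image′ x′∈xs with image (there x′∈xs)
  ... | y′ , y′∈ys , Rx′y′ =
    y′ , ∈-─⁺ y∈ys y′∈ys (λ { refl → All.lookup x∉xs x′∈xs (sym (inj (there x′∈xs) (here refl) Rx′y′ Rxy)) }) , Rx′y′

foldr-⊔-map-mono : ∀ {a} {X : Set a} {f g : X → ℕ} → (∀ x → f x ≤ g x) →
                   ∀ xs → foldr _⊔_ 0 (map f xs) ≤ foldr _⊔_ 0 (map g xs)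
foldr-⊔-map-mono f≤g []       = z≤n
foldr-⊔-map-mono f≤g (x ∷ xs) = ⊔-mono-≤ (f≤g x) (foldr-⊔-map-mono f≤g xs)

-- For the premise measures any conclusion element will do; for the conclusion measures x itself.
occurs-preserved : ∀ μ (x : Fin n) {A B b₀} → Occurs μ x (A , B) → b₀ ∈ B →
                   ∃[ b ] (b ∈ B × ∀ {A′ B′} → A ⊆ A′ → b ∈ B′ → Occurs μ x (A′ , B′))
occurs-preserved cdeg x x∈B        _    = x , x∈B , λ _ x∈B′ → x∈B′
occurs-preserved pdeg x x∈A        b₀∈B = _ , b₀∈B , λ A⊆A′ _ → A⊆A′ x∈A
occurs-preserved deg  x (inj₁ x∈A) b₀∈B = _ , b₀∈B , λ A⊆A′ _ → inj₁ (A⊆A′ x∈A)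
occurs-preserved deg  x (inj₂ x∈B) _    = x , x∈B , λ _ x∈B′ → inj₂ x∈B′

module LowerBound {𝒞 : Family n} (cs : ClosureSystem 𝒞) {Σ* : List (Impl n)} (agg : IsAggCritBase 𝒞 Σ*) where
  open Critical cs
  open AggregatedCriticalBase agg

  Covers : Impl n → Impl n → Set
  Covers (A , _) (A′ , _) = ∃[ b ] (CritGen 𝒞 A b × A ⊆ A′ × A′ ⊆ φ 𝒞 A - b)

  degAt-≤ : ∀ {Σ} → IsIB 𝒞 Σ → ∀ μ x → degAt μ Σ* x ≤ degAt μ Σ x
  degAt-≤ {Σ} ib μ x = length-≤-by-injection Covers (filter⁺ (occurs? μ x) (proj₁ agg)) covered (λ {i} {i′} {j} → injective {i} {i′} {j})
    where
    covered : ∀ {i} → i ∈ₗ filter (occurs? μ x) Σ* → ∃[ j ] (j ∈ₗ filter (occurs? μ x) Σ × Covers i j)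
    covered {A , B} i∈ with ∈-filter⁻ (occurs? μ x) {xs = Σ*} i∈
    ... | i∈Σ* , occ with occurs-preserved μ x occ (proj₂ (conclusion-nonempty i∈Σ*))
    ...   | b , b∈B , occ′ with critical-hit ib (conclusion-critical i∈Σ* b∈B)
    ...     | A′ , B′ , m , A⊆A′ , A′⊆φA-b , b∈B′ =
      (A′ , B′) , ∈-filter⁺ (occurs? μ x) m (occ′ A⊆A′ b∈B′) ,
      b , conclusion-critical i∈Σ* b∈B , A⊆A′ , A′⊆φA-b

    injective : ∀ {i i′ j} → i ∈ₗ filter (occurs? μ x) Σ* → i′ ∈ₗ filter (occurs? μ x) Σ* →
                Covers i j → Covers i′ j → i ≡ i′
    injective {A , B} {A′ , B′} i∈ i′∈ (_ , cg , A⊆D , D⊆) (_ , cg′ , A′⊆D , D⊆′)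
      with critical-premises-unique cg cg′ A⊆D D⊆ A′⊆D D⊆′
    ... | refl = cong₂ _,_ refl (conclusion-unique (proj₁ (∈-filter⁻ (occurs? μ x) {xs = Σ*} i∈))
                                                   (proj₁ (∈-filter⁻ (occurs? μ x) {xs = Σ*} i′∈)))

  degOf-≤ : ∀ {Σ} → IsIB 𝒞 Σ → ∀ μ → degOf μ Σ* ≤ degOf μ Σ
  degOf-≤ ib μ = foldr-⊔-map-mono (degAt-≤ ib μ) (allFin n)

wf-minimal : ∀ {_<_ : Rel (Fin n) ℓ} → WellFounded _<_ → Decidable _<_ →
             ∀ (S : Subset n) {c} → c ∈ S → ∃[ s ] (s ∈ S × ∀ {t} → t ∈ S → ¬ t < s)
wf-minimal {_<_ = _<_} wf _<?_ S c∈S = go (wf _) c∈S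
  where
  go : ∀ {c} → Acc _<_ c → c ∈ S → ∃[ s ] (s ∈ S × ∀ {t} → t ∈ S → ¬ t < s)
  go {c} (acc rec) c∈S with any? (λ t → (t ∈? S) ×-dec (t <? c))
  ... | yes (t , t∈S , t<c) = go (rec t<c) t∈S
  ... | no  ∄t              = c , c∈S , λ t∈S t<c → ∄t (_ , t∈S , t<c)

module Acyclic {𝒞 : Family n} (cs : ClosureSystem 𝒞) {Σ₀ : List (Impl n)} (ib₀ : IsIB 𝒞 Σ₀)
               (acyclic : AcyclicGraph Σ₀) where
  open Closure 𝒞
  open Base cs ib₀

  _⟶_ _⟶⁺_ : Fin n → Fin n → Set
  _⟶_  = Arc Σ₀
  _⟶⁺_ = TransClosure _⟶_

  ⟶⁺-isStrictPartialOrder : IsStrictPartialOrder _≡_ _⟶⁺_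
  ⟶⁺-isStrictPartialOrder = record
    { isEquivalence = isEquivalence
    ; irrefl        = λ { refl → acyclic _ }
    ; trans         = _++_
    ; <-resp-≈      = (λ { refl → id }) , (λ { refl → id })
    }

  _⟶?_ : ∀ a b → Dec (a ⟶ b)
  a ⟶? b = map′ fromAny toAny (Any.any? (λ { (A , B) → (a ∈? A) ×-dec (b ∈? B) }) Σ₀)
    where
    fromAny : Any.Any (λ { (A , B) → a ∈ A × b ∈ B }) Σ₀ → a ⟶ b
    fromAny a⟶b with find a⟶b
    ... | (A , B) , m , a∈A , b∈B = A , B , m , a∈A , b∈B
    toAny : a ⟶ b → Any.Any (λ { (A , B) → a ∈ A × b ∈ B }) Σ₀
    toAny (A , B , m , a∈A , b∈B) = lose m (a∈A , b∈B)

  _⟶⁺?_ : ∀ a b → Dec (a ⟶⁺ b)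
  a ⟶⁺? b = go (spo-noetherian ⟶⁺-isStrictPartialOrder a)
    where
    go : ∀ {a} → Acc (flip _⟶⁺_) a → Dec (a ⟶⁺ b)
    go {a} (acc rec) = map′ fromStep toStep (any? step?)
      where
      step? : ∀ c → Dec (a ⟶ c × (c ≡ b ⊎ c ⟶⁺ b))
      step? c with a ⟶? c
      ... | no  ¬a⟶c = no (¬a⟶c ∘ proj₁)
      ... | yes a⟶c  = map′ (a⟶c ,_) proj₂ ((c ≟ b) ⊎-dec go (rec [ a⟶c ]))
      fromStep : ∃[ c ] (a ⟶ c × (c ≡ b ⊎ c ⟶⁺ b)) → a ⟶⁺ b
      fromStep (_ , a⟶c , inj₁ refl)  = [ a⟶c ]
      fromStep (_ , a⟶c , inj₂ c⟶⁺b) = a⟶c ∷ c⟶⁺b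
      toStep : a ⟶⁺ b → ∃[ c ] (a ⟶ c × (c ≡ b ⊎ c ⟶⁺ b))
      toStep [ a⟶b ]        = _ , a⟶b , inj₁ refl
      toStep (a⟶c ∷ c⟶⁺b) = _ , a⟶c , inj₂ c⟶⁺b

  ⟶⁺-minimal : ∀ (S : Subset n) {c} → c ∈ S → ∃[ s ] (s ∈ S × ∀ {t} → t ∈ S → ¬ t ⟶⁺ s)
  ⟶⁺-minimal = wf-minimal (spo-wellFounded ⟶⁺-isStrictPartialOrder) _⟶⁺?_

  remove-closed : ∀ {P Q s} → P ∈ₗ 𝒞 → Q ∈ₗ 𝒞 → s ∉ Q → (∀ {t} → t ∈ P → t ⟶ s → t ∈ Q) →
                  (P - s) ∈ₗ 𝒞
  remove-closed {P} {s = s} P∈𝒞 Q∈𝒞 s∉Q P∩pred⊆Q = closed respects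
    where
    respects : Respects Σ₀ (P - s)
    respects F E m F⊆P-s {x} x∈E = x∈p∧x≢y⇒x∈p-y (respected P∈𝒞 F E m (x∈p-y⇒x∈p ∘ F⊆P-s) x∈E) λ { refl →
      s∉Q (respected Q∈𝒞 F E m (λ f∈F → P∩pred⊆Q (x∈p-y⇒x∈p (F⊆P-s f∈F)) (F , E , m , f∈F , x∈E)) x∈E) }

  extreme? : ∀ P c → Dec (c ∈ P × (P - c) ∈ₗ 𝒞)
  extreme? P c = (c ∈? P) ×-dec ((P - c) ∈ₗ? 𝒞)

  extremePoints : Subset n → Subset n
  extremePoints P = toSubset (extreme? P)

  krein-milman : ∀ {P} → P ∈ₗ 𝒞 → P ⊆ φ 𝒞 (extremePoints P)
  krein-milman {P} P∈𝒞 c∈P = x∈p∧x∉p─q⇒x∈q c∈P (λ c∈P─Q → no-minimal (⟶⁺-minimal (P ─ Q) c∈P─Q))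
    where
    Q = φ 𝒞 (extremePoints P)
    no-minimal : ¬ (∃[ s ] (s ∈ P ─ Q × ∀ {t} → t ∈ P ─ Q → ¬ t ⟶⁺ s))
    no-minimal (s , s∈P─Q , s-min) = s∉Q (φ-extensive _ (∈-toSubset⁺ (extreme? P) (s∈P , P-s∈𝒞)))
      where
      s∈P = p─q⊆p P Q s∈P─Q
      s∉Q = x∈p─q⇒x∉q P Q s∈P─Q
      P-s∈𝒞 = remove-closed P∈𝒞 (φ-closed cs _) s∉Q
                (λ t∈P t⟶s → x∈p∧x∉p─q⇒x∈q t∈P (λ t∈P─Q → s-min t∈P─Q [ t⟶s ]))

  minGen-extreme : ∀ {A b a} → MinGen 𝒞 A b → a ∈ A → (φ 𝒞 A - a) ∈ₗ 𝒞
  minGen-extreme {A} {a = a} (_ , b∈φA , minimal) a∈A with (φ 𝒞 A - a) ∈ₗ? 𝒞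
  ... | yes φA-a∈𝒞 = φA-a∈𝒞
  ... | no  φA-a∉𝒞 =
    ⊥-elim (minimal (A - a) (x∈p⇒p-x⊂p a∈A) (φ-mono cs ext⊆A-a (krein-milman (φ-closed cs A) b∈φA)))
    where
    ext⊆A-a : extremePoints (φ 𝒞 A) ⊆ A - a
    ext⊆A-a {e} e∈ext with ∈-toSubset⁻ (extreme? (φ 𝒞 A)) e∈ext | e ∈? A
    ... | _    , φA-e∈𝒞 | yes e∈A = x∈p∧x≢y⇒x∈p-y e∈A λ { refl → φA-a∉𝒞 φA-e∈𝒞 }
    ... | e∈φA , φA-e∈𝒞 | no  e∉A = ⊥-elim (φ-remove∉𝒞 e∈φA e∉A φA-e∈𝒞)

  ⟶*? : ∀ b u → Dec (u ≡ b ⊎ u ⟶⁺ b)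
  ⟶*? b u = (u ≟ b) ⊎-dec (u ⟶⁺? b)

  ↓_ : Fin n → Subset n
  ↓ b = toSubset (⟶*? b)

  ↓-downward : ∀ {t x b} → t ⟶ x → x ∈ ↓ b → t ∈ ↓ b
  ↓-downward {b = b} t⟶x x∈↓b with ∈-toSubset⁻ (⟶*? b) x∈↓b
  ... | inj₁ refl  = ∈-toSubset⁺ (⟶*? b) (inj₂ [ t⟶x ])
  ... | inj₂ x⟶⁺b = ∈-toSubset⁺ (⟶*? b) (inj₂ (t⟶x ∷ x⟶⁺b))

  ∪-∁-downset-closed : ∀ {K V} → K ∈ₗ 𝒞 → (∀ {t x} → t ⟶ x → x ∈ V → t ∈ V) → (K ∪ ∁ V) ∈ₗ 𝒞
  ∪-∁-downset-closed {K} {V} K∈𝒞 downward = closed respects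
    where
    respects : Respects Σ₀ (K ∪ ∁ V)
    respects F E m F⊆ {x} x∈E with x ∈? V
    ... | no  x∉V = x∈p∪q⁺ (inj₂ (x∉p⇒x∈∁p x∉V))
    ... | yes x∈V = x∈p∪q⁺ (inj₁ (respected K∈𝒞 F E m F⊆K x∈E))
      where
      F⊆K : F ⊆ K
      F⊆K f∈F with x∈p∪q⁻ K (∁ V) (F⊆ f∈F)
      ... | inj₁ f∈K  = f∈K
      ... | inj₂ f∈∁V = ⊥-elim (x∈∁p⇒x∉p f∈∁V (downward (F , E , m , f∈F , x∈E) x∈V))

  minGen-⊆-↓ : ∀ {A b} → MinGen 𝒞 A b → A ⊆ ↓ b
  minGen-⊆-↓ {A} {b} (_ , b∈φA , minimal) {a} a∈A = decidable-stable (a ∈? ↓ b) λ a∉↓b →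
    minimal (A ∩ ↓ b) (p∩q⊆p A (↓ b) , a , a∈A , a∉↓b ∘ proj₂ ∘ x∈p∩q⁻ A (↓ b)) b∈φ[A∩↓b]
    where
    A⊆ : A ⊆ φ 𝒞 (A ∩ ↓ b) ∪ ∁ (↓ b)
    A⊆ {a} a∈A with a ∈? ↓ b
    ... | yes a∈↓b = x∈p∪q⁺ (inj₁ (φ-extensive _ (x∈p∩q⁺ (a∈A , a∈↓b))))
    ... | no  a∉↓b = x∈p∪q⁺ (inj₂ (x∉p⇒x∈∁p a∉↓b))
    b∈φ[A∩↓b] : b ∈ φ 𝒞 (A ∩ ↓ b)
    b∈φ[A∩↓b] with x∈p∪q⁻ (φ 𝒞 (A ∩ ↓ b)) (∁ (↓ b))
                     (φ-least (∪-∁-downset-closed (φ-closed cs _) ↓-downward) A⊆ b∈φA)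
    ... | inj₁ b∈φ[A∩↓b] = b∈φ[A∩↓b]
    ... | inj₂ b∈∁↓b     =
      ⊥-elim (x∈∁p⇒x∉p b∈∁↓b (∈-toSubset⁺ (⟶*? b) (inj₁ refl)))

  minGen-ancestor : ∀ {A b a} → MinGen 𝒞 A b → a ∈ A → a ⟶⁺ b
  minGen-ancestor {b = b} mg@(b∉A , _) a∈A
    with ∈-toSubset⁻ (⟶*? b) (minGen-⊆-↓ mg a∈A)
  ... | inj₁ refl  = ⊥-elim (b∉A a∈A)
  ... | inj₂ a⟶⁺b = a⟶⁺b

  smaller-minGen : ∀ {A b a} → MinGen 𝒞 A b → a ∈ A → ¬ (φ 𝒞 A - a - b) ∈ₗ 𝒞 →
                   ∃[ A′ ] (MinGen 𝒞 A′ b × φ 𝒞 A′ ⊂ φ 𝒞 A)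
  smaller-minGen {A} mg a∈A φA-a-b∉𝒞 with removal-witness (minGen-extreme mg a∈A) φA-a-b∉𝒞
  ... | F , E , m , F⊆φA-a-b , b∈E
    with minimal-generator-below (conclusion⊆φ-premise m b∈E) (y∉p-y ∘ F⊆φA-a-b)
  ...   | A′ , A′⊆F , mg′ =
    A′ , mg′ , ⊆-⊂-trans (φ-least (minGen-extreme mg a∈A) (x∈p-y⇒x∈p ∘ F⊆φA-a-b ∘ A′⊆F))
                         (x∈p⇒p-x⊂p (φ-extensive A a∈A))

  critical-below : ∀ {A b} → MinGen 𝒞 A b → ∃[ A* ] (CritGen 𝒞 A* b × φ 𝒞 A* ⊆ φ 𝒞 A)
  critical-below {A} {b} = go (On.wellFounded (φ 𝒞) ⊂-wellFounded A)
    where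
    go : ∀ {A} → Acc (_⊂_ on φ 𝒞) A → MinGen 𝒞 A b → ∃[ A* ] (CritGen 𝒞 A* b × φ 𝒞 A* ⊆ φ 𝒞 A)
    go {A} (acc rec) mg with any? (λ a → (a ∈? A) ×-dec ¬? ((φ 𝒞 A - a - b) ∈ₗ? 𝒞))
    ... | no  ∄a = A , (mg , λ a a∈A → decidable-stable (_ ∈ₗ? 𝒞) λ ∉𝒞 → ∄a (a , a∈A , ∉𝒞)) , id
    ... | yes (a , a∈A , φA-a-b∉𝒞) with smaller-minGen mg a∈A φA-a-b∉𝒞
    ...   | A′ , mg′ , φA′⊂φA with go (rec φA′⊂φA) mg′
    ...     | A* , cg , φA*⊆φA′ = A* , cg , proj₁ φA′⊂φA ∘ φA*⊆φA′

  module _ {Σ* : List (Impl n)} (agg : IsAggCritBase 𝒞 Σ*) where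
    open AggregatedCriticalBase agg

    respects-Σ*⇒closed : ∀ {C} → Respects Σ* C → C ∈ₗ 𝒞
    respects-Σ*⇒closed {C} respects with any? (_∈? φ 𝒞 C ─ C)
    ... | no  ∄c = φ⊆⇒∈𝒞 cs λ c∈φC → x∈p∧x∉p─q⇒x∈q c∈φC λ c∈φC─C → ∄c (_ , c∈φC─C)
    ... | yes (c , c∈φC─C) = ⊥-elim (no-minimal (⟶⁺-minimal (φ 𝒞 C ─ C) c∈φC─C))
      where
      no-minimal : ¬ (∃[ s ] (s ∈ φ 𝒞 C ─ C × ∀ {t} → t ∈ φ 𝒞 C ─ C → ¬ t ⟶⁺ s))
      no-minimal (s , s∈φC─C , s-min)
        with minimal-generator-below (p─q⊆p _ C s∈φC─C) (x∈p─q⇒x∉q _ C s∈φC─C)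
      ... | A , A⊆C , mg with critical-below mg
      ...   | A* , cg , φA*⊆φA with critical∈Σ* cg
      ...     | B , m , s∈B = x∈p─q⇒x∉q _ C s∈φC─C (respects A* B m A*⊆C s∈B)
        where
        A*⊆C : A* ⊆ C
        A*⊆C a∈A* = x∈p∧x∉p─q⇒x∈q (φ-mono cs A⊆C (φA*⊆φA (φ-extensive _ a∈A*)))
                                   (λ a∈φC─C → s-min a∈φC─C (minGen-ancestor (proj₁ cg) a∈A*))

    aggregated-critical-base-isIB : IsIB 𝒞 Σ*
    aggregated-critical-base-isIB = record
      { unique   = proj₁ agg
      ; disjoint = λ A B m x x∈A x∈B → proj₁ (proj₁ (conclusion-critical m x∈B)) x∈A
      ; models   = λ C → mk⇔ closed⇒respects respects-Σ*⇒closed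
      }
      where
      closed⇒respects : ∀ {C} → C ∈ₗ 𝒞 → Respects Σ* C
      closed⇒respects C∈𝒞 A B m A⊆C b∈B =
        φ-least C∈𝒞 A⊆C (proj₁ (proj₂ (proj₁ (conclusion-critical m b∈B))))

lemma15 : ∀ {n : ℕ} (𝒞 : Family n) → AcyclicConvexGeometry 𝒞 →
          (Σ* : List (Impl n)) → IsAggCritBase 𝒞 Σ* → (μ : Measure) →
          (∃[ Σ ] (IsIB 𝒞 Σ × degOf μ Σ ≡ degOf μ Σ*)) ×
          (∀ (Σ : List (Impl n)) → IsIB 𝒞 Σ → degOf μ Σ* ≤ degOf μ Σ)
lemma15 𝒞 (cs , Σ₀ , ib₀ , acyclic) Σ* agg μ =
  (Σ* , Acyclic.aggregated-critical-base-isIB cs ib₀ acyclic agg , refl) ,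
  λ Σ ib → LowerBound.degOf-≤ cs agg ib μ
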